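{- Let $G$ be a group acting transitively on a set $X$, let $x\in X$, let $G_x=\{g\in G:gx=x\}$, let $\gamma_x:G\to X$, $\gamma_x(g)=gx$, and let $s:X\to G$ be a section of $\gamma_x$ (i.e. $\gamma_x\circ s=\mathrm{id}_X$). Let $A\subseteq X$ and let $T\subseteq X$ be a $G[A]$-transversal. Then (1) $s(T)$ is a $G[\gamma_x^{ -1}(A)]$-transversal in $G$ (where $G$ acts on itself by left multiplication); (2) $|G|=|G_x|\cdot|A|\cdot|T|$ (as cardinals).
   Context: For a $G$-space $Y$ and $A\subseteq Y$, $G[A]=\{gA:g\in G\}$; a set $T\subseteq Y$ is a $G[A]$-transversal if $|gA\cap T|=1$ for every $g\in G$. -}

module Defs where

open import Level using (Level; _⊔_; suc)
open import Data.Product using (Σ; ∃; _×_; _,_)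
open import Relation.Binary.PropositionalEquality using (_≡_)
open import Algebra.Structures using (IsGroup)
open import Function.Bundles using (_↔_)

record Grp (ℓ : Level) : Set (suc ℓ) where
  field
    Carrier : Set ℓ
    _∙_     : Carrier → Carrier → Carrier
    ε       : Carrier
    _⁻¹     : Carrier → Carrier
    isGroup : IsGroup _≡_ _∙_ ε _⁻¹

record Action {ℓ} (G : Grp ℓ) (ℓy : Level) : Set (ℓ ⊔ suc ℓy) where
  open Grp G
  field
    Space   : Set ℓy
    act     : Carrier → Space → Space
    act-ε   : ∀ y → act ε y ≡ y
    act-∙   : ∀ g h y → act (g ∙ h) y ≡ act g (act h y)

leftMult : ∀ {ℓ} (G : Grp ℓ) → Action G ℓ
leftMult G = record
  { Space = Carrier ; act = _∙_
  ; act-ε = identityˡ ; act-∙ = λ g h y → assoc g h y }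
  where open Grp G ; open IsGroup isGroup

Subset : ∀ {a} (Y : Set a) (p : Level) → Set (a ⊔ suc p)
Subset Y p = Y → Set p

-- A subset is proposition-valued (a genuine subset, not a family).
IsPropSubset : ∀ {a p} {Y : Set a} → Subset Y p → Set (a ⊔ p)
IsPropSubset {Y = Y} A = ∀ (y : Y) (u v : A y) → u ≡ v

translate : ∀ {ℓ ℓy p} {G : Grp ℓ} (𝒴 : Action G ℓy) →
            Grp.Carrier G → Subset (Action.Space 𝒴) p →
            Subset (Action.Space 𝒴) (ℓy ⊔ p)
translate 𝒴 g A y = ∃ λ a → A a × act g a ≡ y
  where open Action 𝒴

IsTransversal : ∀ {ℓ ℓy p q} {G : Grp ℓ} (𝒴 : Action G ℓy) →
                Subset (Action.Space 𝒴) p → Subset (Action.Space 𝒴) q →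
                Set (ℓ ⊔ ℓy ⊔ p ⊔ q)
IsTransversal {G = G} 𝒴 A T =
  ∀ (g : Grp.Carrier G) →
    ∃ λ t → (translate 𝒴 g A t × T t) ×
            (∀ t′ → translate 𝒴 g A t′ × T t′ → t′ ≡ t)

IsTransitive : ∀ {ℓ ℓy} {G : Grp ℓ} → Action G ℓy → Set (ℓ ⊔ ℓy)
IsTransitive {G = G} 𝒴 = ∀ y z → ∃ λ (g : Grp.Carrier G) → Action.act 𝒴 g y ≡ z

Stab : ∀ {ℓ ℓy} {G : Grp ℓ} (𝒴 : Action G ℓy) → Action.Space 𝒴 → Set (ℓ ⊔ ℓy)
Stab {G = G} 𝒴 x = Σ (Grp.Carrier G) λ g → Action.act 𝒴 g x ≡ x

γ : ∀ {ℓ ℓy} {G : Grp ℓ} (𝒴 : Action G ℓy) → Action.Space 𝒴 → Grp.Carrier G → Action.Space 𝒴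
γ 𝒴 x g = Action.act 𝒴 g x

preimage : ∀ {a b p} {Y : Set a} {Z : Set b} → (Y → Z) → Subset Z p → Subset Y p
preimage f A y = A (f y)

image : ∀ {a b p} {Y : Set a} {Z : Set b} → (Y → Z) → Subset Y p → Subset Z (a ⊔ b ⊔ p)
image f T z = ∃ λ y → T y × f y ≡ z

-- The type of elements of a subset (its cardinality is the cardinal |A|).
⟦_⟧ : ∀ {a p} {Y : Set a} → Subset Y p → Set (a ⊔ p)
⟦_⟧ {Y = Y} A = Σ Y A

-- Since γ(gb) = g γ(b) and γ ∘ s = id, a point y lies in gA exactly when
-- s(y) lies in g γ⁻¹(A); this gives (1), and it splits every g ∈ G uniquely
-- as g = s(t) b⁻¹ with t the point of gA ∩ T and b ∈ γ⁻¹(A), so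
-- G ≅ γ⁻¹(A) × T.  By transitivity each fibre of γ is a translate of G_x,
-- so γ⁻¹(A) ≅ G_x × A, which gives (2).
module Submission where

open import Defs
open import Level using (_⊔_)
open import Data.Product using (Σ; _×_; _,_; proj₁; proj₂)
open import Data.Product.Function.Dependent.Propositional using (Σ-↔)
open import Data.Product.Function.NonDependent.Propositional using (_×-↔_)
open import Algebra.Bundles using (Group)
open import Algebra.Structures using (IsGroup)
import Algebra.Properties.Group as GroupProperties
open import Function.Base using (id; _∘_)
open import Function.Bundles using (_↔_; Inverse; mk↔ₛ′)
open import Function.Properties.Inverse using (↔-refl; ↔-sym)
open import Function.Properties.Inverse.HalfAdjointEquivalence using (_≃_; ↔⇒≃)
open import Function.Related.Propositional using (module EquationalReasoning)
open import Function.Related.TypeIsomorphisms using (×-comm; Σ-assoc)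
open import Relation.Binary.PropositionalEquality
  using (_≡_; refl; sym; trans; cong; cong₂; subst; naturality; module ≡-Reasoning)
open import Relation.Binary.PropositionalEquality.Properties
  using (trans-symˡ; trans-assoc; trans-cong; sym-cong; cong-∘; cong-id)

cong-↔ : ∀ {a b} {A : Set a} {B : Set b} (f : A ↔ B) {x y : A} →
         (x ≡ y) ↔ (Inverse.to f x ≡ Inverse.to f y)
cong-↔ f {x} {y} = mk↔ₛ′ (cong to) from′ to∘from′ from′∘to
  where
  open _≃_ (↔⇒≃ f)
  open ≡-Reasoning

  from′ : to x ≡ to y → x ≡ y
  from′ q = trans (sym (left-inverse-of x)) (trans (cong from q) (left-inverse-of y))

  from′∘to : (p : x ≡ y) → from′ (cong to p) ≡ p
  from′∘to refl = trans-symˡ (left-inverse-of x)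

  -- The half-adjoint coherence turns cong to (left-inverse-of _) into
  -- right-inverse-of, after which naturality of right-inverse-of cancels it.
  to∘from′ : (q : to x ≡ to y) → cong to (from′ q) ≡ q
  to∘from′ q = begin
    cong to (trans (sym lx) (trans (cong from q) ly))
      ≡⟨ sym (trans-cong (sym lx)) ⟩
    trans (cong to (sym lx)) (cong to (trans (cong from q) ly))
      ≡⟨ cong₂ trans (sym (sym-cong lx)) (sym (trans-cong (cong from q))) ⟩
    trans (sym (cong to lx)) (trans (cong to (cong from q)) (cong to ly))
      ≡⟨ cong₂ (λ u v → trans (sym u) (trans (cong to (cong from q)) v))
               (left-right x) (left-right y) ⟩
    trans (sym rx) (trans (cong to (cong from q)) ry)
      ≡⟨ cong (λ u → trans (sym rx) (trans u ry)) (sym (cong-∘ q)) ⟩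
    trans (sym rx) (trans (cong (to ∘ from) q) ry)
      ≡⟨ cong (trans (sym rx)) (naturality right-inverse-of) ⟩
    trans (sym rx) (trans rx (cong id q))
      ≡⟨ sym (trans-assoc (sym rx)) ⟩
    trans (trans (sym rx) rx) (cong id q)
      ≡⟨ cong₂ trans (trans-symˡ rx) (cong-id q) ⟩
    q ∎
    where
    lx : from (to x) ≡ x
    lx = left-inverse-of x
    ly : from (to y) ≡ y
    ly = left-inverse-of y
    rx : to (from (to x)) ≡ to x
    rx = right-inverse-of (to x)
    ry : to (from (to y)) ≡ to y
    ry = right-inverse-of (to y)

fibre : ∀ {a b} {Y : Set a} {Z : Set b} → (Y → Z) → Z → Set (a ⊔ b)
fibre f z = Σ _ λ y → f y ≡ z

⟦⟧-≡ : ∀ {a p} {Y : Set a} {A : Subset Y p} → IsPropSubset A →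
       ∀ {y y′} {u : A y} {v : A y′} → y ≡ y′ → _≡_ {A = ⟦ A ⟧} (y , u) (y′ , v)
⟦⟧-≡ propA {y} refl = cong (y ,_) (propA y _ _)

⟦preimage⟧↔Σfibre : ∀ {a b p} {Y : Set a} {Z : Set b} (f : Y → Z) (A : Subset Z p) →
                    ⟦ preimage f A ⟧ ↔ Σ ⟦ A ⟧ (fibre f ∘ proj₁)
⟦preimage⟧↔Σfibre f A = mk↔ₛ′
  (λ (y , fy∈A) → (f y , fy∈A) , (y , refl))
  (λ ((z , z∈A) , (y , fy≡z)) → y , subst A (sym fy≡z) z∈A)
  (λ { ((_ , _) , (_ , refl)) → refl })
  (λ _ → refl)

asGroup : ∀ {ℓ} → Grp ℓ → Group ℓ ℓ
asGroup G = record { isGroup = Grp.isGroup G }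

module _ {ℓ ℓy} {G : Grp ℓ} (𝒴 : Action G ℓy) where
  open Grp G
  open IsGroup isGroup using (inverseˡ; inverseʳ)
  open Action 𝒴

  act-inverseˡ : ∀ g y → act (g ⁻¹) (act g y) ≡ y
  act-inverseˡ g y = begin
    act (g ⁻¹) (act g y) ≡⟨ sym (act-∙ (g ⁻¹) g y) ⟩
    act ((g ⁻¹) ∙ g) y   ≡⟨ cong (λ h → act h y) (inverseˡ g) ⟩
    act ε y              ≡⟨ act-ε y ⟩
    y                    ∎
    where open ≡-Reasoning

  act-inverseʳ : ∀ g y → act g (act (g ⁻¹) y) ≡ y
  act-inverseʳ g y = begin
    act g (act (g ⁻¹) y) ≡⟨ sym (act-∙ g (g ⁻¹) y) ⟩
    act (g ∙ (g ⁻¹)) y   ≡⟨ cong (λ h → act h y) (inverseʳ g) ⟩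
    act ε y              ≡⟨ act-ε y ⟩
    y                    ∎
    where open ≡-Reasoning

  act-↔ : Carrier → Space ↔ Space
  act-↔ g = mk↔ₛ′ (act g) (act (g ⁻¹)) (act-inverseʳ g) (act-inverseˡ g)

module _ {ℓ ℓx} {G : Grp ℓ} (𝒳 : Action G ℓx) where
  open Grp G
  open Action 𝒳

  -- Space need not be a set, so the equality proofs in a fibre have to be
  -- carried along bijectively; cong-↔ does this for the action of k.
  fibre-γ-translate : ∀ k x y → fibre (γ 𝒳 x) y ↔ fibre (γ 𝒳 x) (act k y)
  fibre-γ-translate k x y = Σ-↔ (act-↔ (leftMult G) k) λ {h} →
    subst (λ z → (act h x ≡ y) ↔ (z ≡ act k y)) (sym (act-∙ k h x)) (cong-↔ (act-↔ 𝒳 k))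

  Stab↔fibre-γ : ∀ {k x y} → act k x ≡ y → Stab 𝒳 x ↔ fibre (γ 𝒳 x) y
  Stab↔fibre-γ {k} {x} kx≡y =
    subst (λ z → Stab 𝒳 x ↔ fibre (γ 𝒳 x) z) kx≡y (fibre-γ-translate k x x)

  ⟦preimage-γ⟧↔Stab×⟦⟧ : ∀ {p} → IsTransitive 𝒳 → ∀ x (A : Subset Space p) →
                         ⟦ preimage (γ 𝒳 x) A ⟧ ↔ (Stab 𝒳 x × ⟦ A ⟧)
  ⟦preimage-γ⟧↔Stab×⟦⟧ transitive x A = begin
    ⟦ preimage (γ 𝒳 x) A ⟧         ↔⟨ ⟦preimage⟧↔Σfibre (γ 𝒳 x) A ⟩
    Σ ⟦ A ⟧ (fibre (γ 𝒳 x) ∘ proj₁) ↔⟨ Σ-↔ ↔-refl (λ {(y , _)} →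
                                         ↔-sym (Stab↔fibre-γ (proj₂ (transitive x y)))) ⟩
    (⟦ A ⟧ × Stab 𝒳 x)             ↔⟨ ×-comm _ _ ⟩
    (Stab 𝒳 x × ⟦ A ⟧)             ∎
    where open EquationalReasoning

module _ {ℓ ℓx p} {G : Grp ℓ} (𝒳 : Action G ℓx) {x : Action.Space 𝒳}
         (s : Action.Space 𝒳 → Grp.Carrier G) (section : ∀ y → γ 𝒳 x (s y) ≡ y)
         (A : Subset (Action.Space 𝒳) p) where
  open Grp G
  open Action 𝒳
  open GroupProperties (asGroup G) using (\\-leftDividesˡ; //-rightDividesˡ; x≈z//y; ∙-cancelˡ)
  open ≡-Reasoning

  translate-section⁺ : ∀ {g y} → translate 𝒳 g A y →
                       translate (leftMult G) g (preimage (γ 𝒳 x) A) (s y)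
  translate-section⁺ {g} {y} (a , a∈A , ga≡y) =
    (g ⁻¹) ∙ s y , subst A (sym g⁻¹sy-x≡a) a∈A , \\-leftDividesˡ g (s y)
    where
    g⁻¹sy-x≡a : act ((g ⁻¹) ∙ s y) x ≡ a
    g⁻¹sy-x≡a = begin
      act ((g ⁻¹) ∙ s y) x     ≡⟨ act-∙ (g ⁻¹) (s y) x ⟩
      act (g ⁻¹) (act (s y) x) ≡⟨ cong (act (g ⁻¹)) (trans (section y) (sym ga≡y)) ⟩
      act (g ⁻¹) (act g a)     ≡⟨ act-inverseˡ 𝒳 g a ⟩
      a                        ∎

  translate-section⁻ : ∀ {g y} → translate (leftMult G) g (preimage (γ 𝒳 x) A) (s y) →
                       translate 𝒳 g A y
  translate-section⁻ {g} {y} (b , bx∈A , gb≡sy) = act b x , bx∈A , (begin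
    act g (act b x) ≡⟨ sym (act-∙ g b x) ⟩
    act (g ∙ b) x   ≡⟨ cong (γ 𝒳 x) gb≡sy ⟩
    act (s y) x     ≡⟨ section y ⟩
    y               ∎)

  module _ {q} {T : Subset Space q} (transversal : IsTransversal 𝒳 A T) where

    image-section-transversal : IsTransversal (leftMult G) (preimage (γ 𝒳 x) A) (image s T)
    image-section-transversal g with transversal g
    ... | t , (t∈gA , t∈T) , unique =
      s t , (translate-section⁺ t∈gA , (t , t∈T , refl)) ,
      λ { _ (h∈gB , (t′ , t′∈T , refl)) → cong s (unique t′ (translate-section⁻ h∈gB , t′∈T)) }

    Carrier↔⟦preimage-γ⟧×⟦⟧ : IsPropSubset A → IsPropSubset T →
                              Carrier ↔ (⟦ preimage (γ 𝒳 x) A ⟧ × ⟦ T ⟧)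
    Carrier↔⟦preimage-γ⟧×⟦⟧ propA propT = mk↔ₛ′ split merge split∘merge merge∘split
      where
      split : Carrier → ⟦ preimage (γ 𝒳 x) A ⟧ × ⟦ T ⟧
      split g = let (t , (t∈gA , t∈T) , _) = transversal g
                    (b , b∈B , _) = translate-section⁺ t∈gA
                in (b , b∈B) , (t , t∈T)

      merge : ⟦ preimage (γ 𝒳 x) A ⟧ × ⟦ T ⟧ → Carrier
      merge ((b , _) , (t , _)) = s t ∙ (b ⁻¹)

      merge∘split : ∀ g → merge (split g) ≡ g
      merge∘split g = let (t , (t∈gA , _) , _) = transversal g
                          (b , _ , gb≡st) = translate-section⁺ t∈gA
                      in sym (x≈z//y g b (s t) gb≡st)

      split∘merge : ∀ bt → split (merge bt) ≡ bt
      split∘merge ((b , b∈B) , (t , t∈T)) =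
        cong₂ _,_ (⟦⟧-≡ (λ h → propA (act h x)) b′≡b) (⟦⟧-≡ propT t′≡t)
        where
        g : Carrier
        g = s t ∙ (b ⁻¹)
        gb≡st : g ∙ b ≡ s t
        gb≡st = //-rightDividesˡ b (s t)
        t′ : Space
        t′ = proj₁ (transversal g)
        b′ : Carrier
        b′ = proj₁ (proj₁ (split g))
        t′≡t : t′ ≡ t
        t′≡t = sym (proj₂ (proj₂ (transversal g)) t (translate-section⁻ (b , b∈B , gb≡st) , t∈T))
        b′≡b : b′ ≡ b
        b′≡b = ∙-cancelˡ g b′ b (begin
          g ∙ b′ ≡⟨ \\-leftDividesˡ g (s t′) ⟩
          s t′   ≡⟨ cong s t′≡t ⟩
          s t    ≡⟨ sym gb≡st ⟩
          g ∙ b  ∎)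

proposition1p7 : ∀ {ℓ ℓx p q} (G : Grp ℓ) (𝒳 : Action G ℓx) →
    IsTransitive 𝒳 →
    (x : Action.Space 𝒳) →
    (s : Action.Space 𝒳 → Grp.Carrier G) → (∀ y → γ 𝒳 x (s y) ≡ y) →
    (A : Subset (Action.Space 𝒳) p) → IsPropSubset A →
    (T : Subset (Action.Space 𝒳) q) → IsPropSubset T →
    IsTransversal 𝒳 A T →
      IsTransversal (leftMult G) (preimage (γ 𝒳 x) A) (image s T)
      × (Grp.Carrier G ↔ (Stab 𝒳 x × ⟦ A ⟧ × ⟦ T ⟧))
proposition1p7 G 𝒳 transitive x s section A propA T propT transversal =
  image-section-transversal 𝒳 s section A transversal , (begin
    Grp.Carrier G
      ↔⟨ Carrier↔⟦preimage-γ⟧×⟦⟧ 𝒳 s section A transversal propA propT ⟩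
    (⟦ preimage (γ 𝒳 x) A ⟧ × ⟦ T ⟧)
      ↔⟨ ⟦preimage-γ⟧↔Stab×⟦⟧ 𝒳 transitive x A ×-↔ ↔-refl ⟩
    ((Stab 𝒳 x × ⟦ A ⟧) × ⟦ T ⟧)
      ↔⟨ Σ-assoc ⟩
    (Stab 𝒳 x × ⟦ A ⟧ × ⟦ T ⟧) ∎)
  where open EquationalReasoning
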